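{- Let $n\ge 2$, $1\le h(1)\le n$, $h=(h(1),n,\ldots,n)$, and let $P_h$ be the poset on $[n]$ with $i<_{P_h}j$ iff $h(i)<j$. Let $B_1$ be the set of monomials $x_1^{i_1}\cdots x_n^{i_n}$ with $0\le i_j\le n-j$ for all $j$ that are not divisible by $\prod_{\ell=1}^{h(1)}x_\ell$. Define $\varphi$ on $B_1$ as follows: start with a column consisting of one box containing $n$; for $k=n-1,n-2,\ldots,1$ in turn, insert a new box containing $k$ into the column at the unique position such that exactly $i_k$ of the entries already in the column lie below it. Call the result $T_0$. If $i_1=0$, set $\varphi(x_1^{i_1}\cdots x_n^{i_n})=T_0$. Otherwise let $k'$ be the smallest index in $\{1,\ldots,h(1)\}$ with $i_{k'}=0$ (then $k'$ occupies the bottom box of $T_0$), and let $\varphi(x_1^{i_1}\cdots x_n^{i_n})$ be the column obtained from $T_0$ by removing $k'$ from the bottom and reinserting it directly below the entry $1$. Then $\varphi$ is a well-defined map from $B_1$ to the set of $P_h$-tableaux of shape $(1^n)$, and it is a bijection.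
   Context: A $P$-tableau of shape $\lambda$ (for a poset $P$ on $[n]$, French convention: rows are read bottom to top, the first/longest row at the bottom) is a filling of the Young diagram of $\lambda$ using each element of $[n]$ exactly once such that if $j$ is directly to the right of $i$ then $j>_P i$, and if $j$ is directly above $i$ then $j\not<_P i$. A tableau of shape $(1^n)$ is a single column of $n$ boxes. -}

module Defs where

open import Data.Nat using (ℕ; zero; suc; _∸_; _≤_; _<_; _≡ᵇ_; _<ᵇ_)
open import Data.Bool using (Bool; true; false; if_then_else_)
open import Data.Fin using (Fin; toℕ)
open import Data.Vec using (Vec; lookup; tabulate; toList)
open import Data.Vec.Relation.Binary.Pointwise.Inductive using (Pointwise)
open import Data.List using (List; []; _∷_; map; upTo)
open import Data.List.Relation.Binary.Permutation.Propositional using (_↭_)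
open import Data.Product using (_×_)
open import Data.Unit using (⊤)
open import Relation.Nullary using (¬_)

range : ℕ → List ℕ
range n = map suc (upTo n)

-- A column tableau (shape (1^n)) is a list of entries read bottom to top.
-- Vertical condition: if j is directly above i then not (j <_P i).
ColAdj : (ℕ → ℕ → Set) → List ℕ → Set
ColAdj _<P_ [] = ⊤
ColAdj _<P_ (x ∷ []) = ⊤
ColAdj _<P_ (x ∷ y ∷ r) = ¬ (y <P x) × ColAdj _<P_ (y ∷ r)

-- P-tableau of shape (1^n) for a poset P on [n] (no horizontal adjacencies exist)
IsColumnPTableau : ℕ → (ℕ → ℕ → Set) → List ℕ → Set
IsColumnPTableau n _<P_ T = (T ↭ range n) × ColAdj _<P_ T

hfun : ℕ → ℕ → ℕ → ℕ
hfun n h1 i = if i ≡ᵇ 1 then h1 else n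

_<Ph[_,_]_ : ℕ → ℕ → ℕ → ℕ → Set
i <Ph[ n , h1 ] j = hfun n h1 i < j

-- Monomials x_1^{i_1}...x_n^{i_n} as exponent vectors (index j : Fin n stands for x_{j+1})
Monomial : ℕ → Set
Monomial n = Vec ℕ n

_∣ₘ_ : ∀ {n} → Monomial n → Monomial n → Set
a ∣ₘ b = Pointwise _≤_ a b

prodFirst : (n h1 : ℕ) → Monomial n
prodFirst n h1 = tabulate (λ j → if toℕ j <ᵇ h1 then 1 else 0)

InB1 : (n h1 : ℕ) → Monomial n → Set
InB1 n h1 v = (∀ (j : Fin n) → lookup v j ≤ n ∸ suc (toℕ j)) × ¬ (prodFirst n h1 ∣ₘ v)

-- 1-based exponent lookup: expo v k = i_k (0 outside range)
nth : List ℕ → ℕ → ℕ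
nth [] _ = 0
nth (x ∷ xs) zero = x
nth (x ∷ xs) (suc i) = nth xs i

expo : ∀ {n} → Monomial n → ℕ → ℕ
expo v k = nth (toList v) (k ∸ 1)

insertAt : ℕ → ℕ → List ℕ → List ℕ
insertAt zero x ys = x ∷ ys
insertAt (suc p) x [] = x ∷ []
insertAt (suc p) x (y ∷ ys) = y ∷ insertAt p x ys

insertDown : ∀ {n} → Monomial n → ℕ → List ℕ → List ℕ
insertDown v zero col = col
insertDown v (suc k) col = insertDown v k (insertAt (expo v (suc k)) (suc k) col)

T0 : (n : ℕ) → Monomial n → List ℕ
T0 n v = insertDown v (n ∸ 1) (n ∷ [])

-- smallest k in {s, ..., s+c-1} with i_k = 0 (fallback s+c, never used on B_1)
searchZero : ∀ {n} → Monomial n → ℕ → ℕ → ℕ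
searchZero v s zero = s
searchZero v s (suc c) = if expo v s ≡ᵇ 0 then s else searchZero v (suc s) c

kprime : ∀ {n} → ℕ → Monomial n → ℕ
kprime h1 v = searchZero v 1 h1

removeEntry : ℕ → List ℕ → List ℕ
removeEntry x [] = []
removeEntry x (y ∷ ys) = if y ≡ᵇ x then ys else y ∷ removeEntry x ys

insertBelow1 : ℕ → List ℕ → List ℕ
insertBelow1 x [] = []
insertBelow1 x (y ∷ ys) = if y ≡ᵇ 1 then x ∷ y ∷ ys else y ∷ insertBelow1 x ys

φ : (n h1 : ℕ) → Monomial n → List ℕ
φ n h1 v =
  if expo v 1 ≡ᵇ 0
  then T0 n v
  else insertBelow1 (kprime h1 v) (removeEntry (kprime h1 v) (T0 n v))

-- φ factors as raiseBottom ∘ T0. Read as insertion by a Lehmer code, T0 is a bijection from the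
-- exponent vectors with i_j ≤ n − j onto the orderings of [n], and the bottom entry of T0 v is one
-- more than the index of the first zero exponent of v. Hence B₁ corresponds to the orderings whose
-- bottom entry is at most h(1), and on B₁ the paper's k′ is exactly that bottom entry. In P_h every
-- j ≥ 2 is maximal, so the only possible violation in a column is 1 directly above an entry larger
-- than h(1). Moving the bottom entry up to just below 1 is therefore a bijection between the two
-- sets of orderings; its inverse moves the entry below 1 back down to the bottom.

module Submission where

open import Defs
open import Data.Bool using (true; false; if_then_else_; T)
open import Data.Empty using (⊥-elim)
open import Data.Fin using (toℕ; fromℕ<) renaming (zero to fzero; suc to fsuc)
open import Data.Fin.Properties using (toℕ-fromℕ<)
open import Data.List
  using (List; []; _∷_; [_]; _++_; _∷ʳ_; length; drop; applyUpTo; initLast; _∷ʳ′_)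
open import Data.List.Properties
  using (map-upTo; ∷-injectiveˡ; ∷-injectiveʳ; ∷ʳ-injective; ∷ʳ-++; ++-conicalʳ)
open import Data.List.Membership.Propositional using (_∈_; _∉_)
open import Data.List.Membership.Propositional.Properties using (∈-∃++)
open import Data.List.Relation.Unary.All as All using (All; []; _∷_)
open import Data.List.Relation.Unary.All.Properties using (All¬⇒¬Any; ++⁻)
open import Data.List.Relation.Unary.Any as Any using (here; there)
open import Data.List.Relation.Binary.Permutation.Propositional
  using (_↭_; ↭-refl; ↭-sym; ↭-trans; ↭-prep; ↭-swap; module PermutationReasoning)
open import Data.List.Relation.Binary.Permutation.Propositional.Properties
  using (All-resp-↭; ∈-resp-↭; ↭-length; ↭-empty-inv; drop-∷; drop-mid; ∷↭∷ʳ; ++⁺ʳ)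
open import Data.Nat
  using (ℕ; zero; suc; _+_; _∸_; _≤_; _<_; _≡ᵇ_; _<ᵇ_; z≤n; s≤s; s≤s⁻¹; _≟_; _<?_)
open import Data.Nat.Properties
  using (+-identityʳ; +-suc; ≤-refl; <⇒≤; <⇒≢; ≤⇒≯; ≮⇒≥; ≰⇒>; n≮n; m<m+n; <-≤-trans;
         <ᵇ⇒<)
open import Data.Product using (Σ; ∃; ∃₂; _×_; _,_; proj₁; proj₂)
open import Data.Unit using (tt)
open import Data.Vec using (Vec; []; _∷_; lookup; toList)
open import Data.Vec.Properties using (length-toList; lookup∘tabulate; tabulate∘lookup)
import Data.Vec.Relation.Binary.Pointwise.Inductive as Pointwise
open import Function using (_∘_; _⇔_; mk⇔; Equivalence)
open import Relation.Nullary using (¬_; yes; no)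
open import Relation.Nullary.Decidable using (dec-true; dec-false)
open import Relation.Binary.PropositionalEquality
  using (_≡_; _≢_; refl; sym; trans; cong; cong₂; subst; subst₂; module ≡-Reasoning)

≡ᵇ-refl : ∀ x → (x ≡ᵇ x) ≡ true
≡ᵇ-refl x = dec-true (x ≟ x) refl

≢⇒≡ᵇ-false : ∀ {x y} → y ≢ x → (y ≡ᵇ x) ≡ false
≢⇒≡ᵇ-false {x} {y} = dec-false (y ≟ x)

∉⇒≡ᵇ-false : ∀ {x y ys} → x ∉ y ∷ ys → (y ≡ᵇ x) ≡ false
∉⇒≡ᵇ-false x∉ = ≢⇒≡ᵇ-false (λ y≡x → x∉ (here (sym y≡x)))

split-at-first-unique : ∀ {A : Set} {y : A} xs xs′ {ys ys′} → y ∉ xs → y ∉ xs′ →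
  xs ++ y ∷ ys ≡ xs′ ++ y ∷ ys′ → xs ≡ xs′ × ys ≡ ys′
split-at-first-unique []       []         _  _   eq = refl , ∷-injectiveʳ eq
split-at-first-unique []       (x′ ∷ xs′) _  y∉′ eq =
  ⊥-elim (y∉′ (here (∷-injectiveˡ eq)))
split-at-first-unique (x ∷ xs) []         y∉ _   eq =
  ⊥-elim (y∉ (here (sym (∷-injectiveˡ eq))))
split-at-first-unique (x ∷ xs) (x′ ∷ xs′) y∉ y∉′ eq
  with refl ← ∷-injectiveˡ eq
  with refl , refl ← split-at-first-unique xs xs′ (y∉ ∘ there) (y∉′ ∘ there) (∷-injectiveʳ eq)
  = refl , refl

rotateˡ : ∀ {A : Set} → List A → List A
rotateˡ []       = []
rotateˡ (x ∷ xs) = xs ∷ʳ x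

rotateˡ-↭ : ∀ {A : Set} (xs : List A) → rotateˡ xs ↭ xs
rotateˡ-↭ []       = ↭-refl
rotateˡ-↭ (x ∷ xs) = ↭-sym (∷↭∷ʳ x xs)

rotateˡ-injective : ∀ {A : Set} (xs ys : List A) → rotateˡ xs ≡ rotateˡ ys → xs ≡ ys
rotateˡ-injective []       []       _  = refl
rotateˡ-injective []       (y ∷ ys) eq with () ← ++-conicalʳ ys [ y ] (sym eq)
rotateˡ-injective (x ∷ xs) []       eq with () ← ++-conicalʳ xs [ x ] eq
rotateˡ-injective (x ∷ xs) (y ∷ ys) eq with refl , refl ← ∷ʳ-injective xs ys eq = refl

ColAdj-adjacent : ∀ {R : ℕ → ℕ → Set} xs {a b ys} → ColAdj R (xs ++ a ∷ b ∷ ys) → ¬ R b a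
ColAdj-adjacent []            (¬bRa , _) = ¬bRa
ColAdj-adjacent (x ∷ [])      (_ , adj)  = ColAdj-adjacent [] adj
ColAdj-adjacent (x ∷ x′ ∷ xs) (_ , adj)  = ColAdj-adjacent (x′ ∷ xs) adj

-- Lehmer codes

interval : ℕ → ℕ → List ℕ
interval k zero    = []
interval k (suc c) = k ∷ interval (suc k) c

length-interval : ∀ k c → length (interval k c) ≡ c
length-interval k zero    = refl
length-interval k (suc c) = cong suc (length-interval (suc k) c)

interval-bounds : ∀ k c → All (λ y → k ≤ y × y < k + c) (interval k c)
interval-bounds k zero    = []
interval-bounds k (suc c) = (≤-refl , m<m+n k (s≤s z≤n)) ∷ All.map widen (interval-bounds (suc k) c)
  where
  widen : ∀ {y} → suc k ≤ y × y < suc k + c → k ≤ y × y < k + suc c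
  widen {y} (k<y , y<) = <⇒≤ k<y , subst (y <_) (sym (+-suc k c)) y<

applyUpTo-interval : ∀ {f : ℕ → ℕ} k c → (∀ i → f i ≡ k + i) →
  applyUpTo f c ≡ interval k c
applyUpTo-interval k zero    _  = refl
applyUpTo-interval k (suc c) f≗ = cong₂ _∷_ (trans (f≗ 0) (+-identityʳ k))
  (applyUpTo-interval (suc k) c (λ i → trans (f≗ (suc i)) (+-suc k i)))

range≡interval : ∀ n → range n ≡ interval 1 n
range≡interval n = trans (map-upTo suc n) (applyUpTo-interval 1 n (λ _ → refl))

insertAt-↭ : ∀ p x L → insertAt p x L ↭ x ∷ L
insertAt-↭ zero    x L        = ↭-refl
insertAt-↭ (suc p) x []       = ↭-refl
insertAt-↭ (suc p) x (y ∷ ys) = ↭-trans (↭-prep y (insertAt-↭ p x ys)) (↭-swap y x ↭-refl)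

pos : ℕ → List ℕ → ℕ
pos x []       = 0
pos x (y ∷ ys) = if y ≡ᵇ x then 0 else suc (pos x ys)

pos-insertAt : ∀ e x L → e ≤ length L → x ∉ L → pos x (insertAt e x L) ≡ e
pos-insertAt zero    x L        _        _  rewrite ≡ᵇ-refl x = refl
pos-insertAt (suc e) x (y ∷ ys) (s≤s e≤) x∉ rewrite ∉⇒≡ᵇ-false x∉ =
  cong suc (pos-insertAt e x ys e≤ (x∉ ∘ there))

removeEntry-insertAt : ∀ e x L → x ∉ L → removeEntry x (insertAt e x L) ≡ L
removeEntry-insertAt zero    x L        _  rewrite ≡ᵇ-refl x = refl
removeEntry-insertAt (suc e) x []       _  rewrite ≡ᵇ-refl x = refl
removeEntry-insertAt (suc e) x (y ∷ ys) x∉ rewrite ∉⇒≡ᵇ-false x∉ =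
  cong (y ∷_) (removeEntry-insertAt e x ys (x∉ ∘ there))

removeEntry-head : ∀ x L → removeEntry x (x ∷ L) ≡ L
removeEntry-head x L rewrite ≡ᵇ-refl x = refl

insertAt-pos : ∀ x T → x ∈ T → insertAt (pos x T) x (removeEntry x T) ≡ T
insertAt-pos x (y ∷ ys) x∈ with y ≟ x
... | yes refl rewrite ≡ᵇ-refl y = refl
... | no y≢x rewrite ≢⇒≡ᵇ-false y≢x =
  cong (y ∷_) (insertAt-pos x ys (Any.tail (y≢x ∘ sym) x∈))

pos-bound : ∀ x T → x ∈ T → pos x T ≤ length (removeEntry x T)
pos-bound x (y ∷ ys) x∈ with y ≟ x
... | yes refl rewrite ≡ᵇ-refl y = z≤n
... | no y≢x rewrite ≢⇒≡ᵇ-false y≢x =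
  s≤s (pos-bound x ys (Any.tail (y≢x ∘ sym) x∈))

removeEntry-↭ : ∀ {x T S} → T ↭ x ∷ S → removeEntry x T ↭ S
removeEntry-↭ {x} {T} {S} T↭xS = drop-∷ (begin
  x ∷ removeEntry x T                     ↭⟨ insertAt-↭ (pos x T) x _ ⟨
  insertAt (pos x T) x (removeEntry x T)  ≡⟨ insertAt-pos x T x∈T ⟩
  T                                       ↭⟨ T↭xS ⟩
  x ∷ S                                   ∎)
  where
  open PermutationReasoning
  x∈T = ∈-resp-↭ (↭-sym T↭xS) (here refl)

fromCode : ℕ → List ℕ → List ℕ
fromCode k []       = []
fromCode k (e ∷ es) = insertAt e k (fromCode (suc k) es)

fromCode-↭ : ∀ k es → fromCode k es ↭ interval k (length es)
fromCode-↭ k []       = ↭-refl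
fromCode-↭ k (e ∷ es) = ↭-trans (insertAt-↭ e k _) (↭-prep k (fromCode-↭ (suc k) es))

length-fromCode : ∀ k es → length (fromCode k es) ≡ length es
length-fromCode k es = trans (↭-length (fromCode-↭ k es)) (length-interval k (length es))

∉-fromCode : ∀ k es → k ∉ fromCode (suc k) es
∉-fromCode k es = All¬⇒¬Any (All.map (<⇒≢ ∘ proj₁)
  (All-resp-↭ (↭-sym (fromCode-↭ (suc k) es)) (interval-bounds (suc k) (length es))))

IsLehmerCode : ∀ {n} → Vec ℕ n → Set
IsLehmerCode {n} v = ∀ i → lookup v i ≤ n ∸ suc (toℕ i)

toCode : ℕ → (c : ℕ) → List ℕ → Vec ℕ c
toCode k zero    T = []
toCode k (suc c) T = pos k T ∷ toCode (suc k) c (removeEntry k T)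

toCode-fromCode : ∀ k {c} (v : Vec ℕ c) → IsLehmerCode v →
  toCode k c (fromCode k (toList v)) ≡ v
toCode-fromCode k []               _    = refl
toCode-fromCode k {suc c} (e ∷ es) code = cong₂ _∷_
  (pos-insertAt e k rest e≤ (∉-fromCode k (toList es)))
  (trans (cong (toCode (suc k) c) (removeEntry-insertAt e k rest (∉-fromCode k (toList es))))
         (toCode-fromCode (suc k) es (code ∘ fsuc)))
  where
  rest = fromCode (suc k) (toList es)
  e≤ : e ≤ length rest
  e≤ = subst (e ≤_) (sym (trans (length-fromCode (suc k) (toList es)) (length-toList es)))
             (code fzero)

fromCode-toCode : ∀ k c {T} → T ↭ interval k c → fromCode k (toList (toCode k c T)) ≡ T
fromCode-toCode k zero    T↭ = sym (↭-empty-inv T↭)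
fromCode-toCode k (suc c) {T} T↭ =
  trans (cong (insertAt (pos k T) k) (fromCode-toCode (suc k) c (removeEntry-↭ T↭)))
        (insertAt-pos k T (∈-resp-↭ (↭-sym T↭) (here refl)))

toCode-isLehmerCode : ∀ k c {T} → T ↭ interval k c → IsLehmerCode (toCode k c T)
toCode-isLehmerCode k (suc c) {T} T↭ fzero =
  subst (pos k T ≤_) (trans (↭-length (removeEntry-↭ T↭)) (length-interval (suc k) c))
        (pos-bound k T (∈-resp-↭ (↭-sym T↭) (here refl)))
toCode-isLehmerCode k (suc c) T↭ (fsuc i) = toCode-isLehmerCode (suc k) c (removeEntry-↭ T↭) i

drop-nth : ∀ k (l : List ℕ) → k < length l → drop k l ≡ nth l k ∷ drop (suc k) l
drop-nth zero    (x ∷ l) _       = refl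
drop-nth (suc k) (x ∷ l) (s≤s k<) = drop-nth k l k<

insertDown-fromCode : ∀ {n} (v : Vec ℕ n) k → k < n →
  insertDown v k (fromCode (suc k) (drop k (toList v))) ≡ fromCode 1 (toList v)
insertDown-fromCode v zero    _   = refl
insertDown-fromCode v (suc k) k<n =
  trans (cong (insertDown v k ∘ fromCode (suc k)) (sym (drop-nth k (toList v) k<length)))
        (insertDown-fromCode v k (<⇒≤ k<n))
  where
  k<length : k < length (toList v)
  k<length = subst (k <_) (sym (length-toList v)) (<⇒≤ k<n)

fromCode-drop-last : ∀ {m} k (v : Vec ℕ (suc m)) → fromCode k (drop m (toList v)) ≡ [ k ]
fromCode-drop-last {zero}  k (zero ∷ [])  = refl
fromCode-drop-last {zero}  k (suc _ ∷ []) = refl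
fromCode-drop-last {suc m} k (_ ∷ v)      = fromCode-drop-last k v

T0≡fromCode : ∀ {m} (v : Vec ℕ (suc m)) → T0 (suc m) v ≡ fromCode 1 (toList v)
T0≡fromCode {m} v =
  trans (cong (insertDown v m) (sym (fromCode-drop-last (suc m) v))) (insertDown-fromCode v m ≤-refl)

T0-↭ : ∀ {m} (v : Vec ℕ (suc m)) → T0 (suc m) v ↭ range (suc m)
T0-↭ {m} v = subst₂ _↭_ (sym (T0≡fromCode v))
  (trans (cong (interval 1) (length-toList v)) (sym (range≡interval (suc m))))
  (fromCode-↭ 1 (toList v))

T0-injective : ∀ {m} (v w : Vec ℕ (suc m)) → IsLehmerCode v → IsLehmerCode w →
  T0 (suc m) v ≡ T0 (suc m) w → v ≡ w
T0-injective {m} v w code-v code-w T0v≡T0w = begin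
  v                         ≡⟨ toCode-fromCode 1 v code-v ⟨
  decode (fromCode 1 (toList v)) ≡⟨ cong decode (T0≡fromCode v) ⟨
  decode (T0 (suc m) v)     ≡⟨ cong decode T0v≡T0w ⟩
  decode (T0 (suc m) w)     ≡⟨ cong decode (T0≡fromCode w) ⟩
  decode (fromCode 1 (toList w)) ≡⟨ toCode-fromCode 1 w code-w ⟩
  w                         ∎
  where
  open ≡-Reasoning
  decode = toCode 1 (suc m)

T0-surjective : ∀ {m C} → C ↭ range (suc m) → ∃ λ v → IsLehmerCode v × T0 (suc m) v ≡ C
T0-surjective {m} {C} C↭ =
  toCode 1 (suc m) C , toCode-isLehmerCode 1 (suc m) C↭′ ,
  trans (T0≡fromCode (toCode 1 (suc m) C)) (fromCode-toCode 1 (suc m) C↭′)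
  where
  C↭′ : C ↭ interval 1 (suc m)
  C↭′ = subst (C ↭_) (range≡interval (suc m)) C↭

-- The first zero exponent

firstZero : ∀ {n} → Vec ℕ n → ℕ
firstZero []          = 0
firstZero (zero ∷ _)  = 0
firstZero (suc _ ∷ v) = suc (firstZero v)

lookup-<firstZero : ∀ {n} (v : Vec ℕ n) i → toℕ i < firstZero v → 0 < lookup v i
lookup-<firstZero (suc x ∷ v) fzero    _        = s≤s z≤n
lookup-<firstZero (suc x ∷ v) (fsuc i) (s≤s i<) = lookup-<firstZero v i i<

lookup-firstZero : ∀ {n} (v : Vec ℕ n) (fz<n : firstZero v < n) → lookup v (fromℕ< fz<n) ≡ 0
lookup-firstZero (zero ∷ v)  _          = refl
lookup-firstZero (suc x ∷ v) (s≤s fz<n) = lookup-firstZero v fz<n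

fromCode-head : ∀ k {c} (v : Vec ℕ (suc c)) → IsLehmerCode v →
  ∃ λ M → fromCode k (toList v) ≡ k + firstZero v ∷ M
fromCode-head k (zero ∷ v) _ = rest , cong (_∷ rest) (sym (+-identityʳ k))
  where rest = fromCode (suc k) (toList v)
fromCode-head k {zero} (suc e ∷ []) code with () ← code fzero
fromCode-head k {suc c} (suc e ∷ v) code with fromCode-head (suc k) v (code ∘ fsuc)
... | M , eq = insertAt e k M ,
  trans (cong (insertAt (suc e) k) eq) (cong (_∷ insertAt e k M) (sym (+-suc k (firstZero v))))

T0-head : ∀ {m} (v : Vec ℕ (suc m)) → IsLehmerCode v →
  ∃ λ M → T0 (suc m) v ≡ suc (firstZero v) ∷ M
T0-head v code with fromCode-head 1 v code
... | M , eq = M , trans (T0≡fromCode v) eq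

searchZero-∷ : ∀ {n} x (v : Vec ℕ n) t c →
  searchZero (x ∷ v) (suc (suc t)) c ≡ suc (searchZero v (suc t) c)
searchZero-∷ x v t zero = refl
searchZero-∷ x v t (suc c) with nth (toList v) t ≡ᵇ 0
... | true  = refl
... | false = searchZero-∷ x v (suc t) c

kprime-firstZero : ∀ {n} h1 (v : Vec ℕ n) → firstZero v < h1 → kprime h1 v ≡ suc (firstZero v)
kprime-firstZero (suc h) []          _          = refl
kprime-firstZero (suc h) (zero ∷ v)  _          = refl
kprime-firstZero (suc h) (suc x ∷ v) (s≤s fz<h) =
  trans (searchZero-∷ (suc x) v 0 h) (cong suc (kprime-firstZero h v fz<h))

prodFirst-∣ₘ : ∀ {n} h1 (v : Monomial n) → h1 ≤ firstZero v → prodFirst n h1 ∣ₘ v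
prodFirst-∣ₘ {n} h1 v h1≤fz =
  subst (prodFirst n h1 ∣ₘ_) (tabulate∘lookup v) (Pointwise.tabulate⁺ entry)
  where
  entry : ∀ i → (if toℕ i <ᵇ h1 then 1 else 0) ≤ lookup v i
  entry i with toℕ i <ᵇ h1 in i<ᵇh1
  ... | false = z≤n
  ... | true  =
    lookup-<firstZero v i (<-≤-trans (<ᵇ⇒< (toℕ i) h1 (subst T (sym i<ᵇh1) tt)) h1≤fz)

prodFirst-∤ : ∀ {n} h1 (v : Monomial n) → firstZero v < h1 → h1 ≤ n → ¬ (prodFirst n h1 ∣ₘ v)
prodFirst-∤ {n} h1 v fz<h1 h1≤n ∣ =
  n≮n 0 (subst₂ _≤_ prodFirst-at-fz (lookup-firstZero v fz<n)
                    (Pointwise.lookup ∣ (fromℕ< fz<n)))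
  where
  fz<n = <-≤-trans fz<h1 h1≤n
  prodFirst-at-fz : lookup (prodFirst n h1) (fromℕ< fz<n) ≡ 1
  prodFirst-at-fz rewrite lookup∘tabulate (λ j → if toℕ j <ᵇ h1 then 1 else 0) (fromℕ< fz<n)
                        | toℕ-fromℕ< fz<n
                        | dec-true (firstZero v <? h1) fz<h1 = refl

InB1⇔ : ∀ {n h1} (v : Monomial n) → h1 ≤ n →
  InB1 n h1 v ⇔ (IsLehmerCode v × firstZero v < h1)
InB1⇔ {h1 = h1} v h1≤n = mk⇔
  (λ (code , ∤) → code , ≰⇒> (∤ ∘ prodFirst-∣ₘ h1 v))
  (λ (code , fz<) → code , prodFirst-∤ h1 v fz< h1≤n)

-- Moving the bottom entry below 1

insertBelow1-++ : ∀ b xs ys → 1 ∉ xs →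
  insertBelow1 b (xs ++ 1 ∷ ys) ≡ (xs ∷ʳ b) ++ 1 ∷ ys
insertBelow1-++ b []       ys _    = refl
insertBelow1-++ b (x ∷ xs) ys 1∉xs rewrite ∉⇒≡ᵇ-false 1∉xs =
  cong (x ∷_) (insertBelow1-++ b xs ys (1∉xs ∘ there))

raiseBottom : List ℕ → List ℕ
raiseBottom []      = []
raiseBottom (b ∷ M) = if b ≡ᵇ 1 then b ∷ M else insertBelow1 b M

bottom : List ℕ → ℕ
bottom []      = 0
bottom (b ∷ _) = b

raiseBottom-split : ∀ xs ys → 1 ∉ xs → raiseBottom (xs ++ 1 ∷ ys) ≡ rotateˡ xs ++ 1 ∷ ys
raiseBottom-split []       ys _     = refl
raiseBottom-split (b ∷ xs) ys 1∉bxs rewrite ∉⇒≡ᵇ-false 1∉bxs =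
  insertBelow1-++ b xs ys (1∉bxs ∘ there)

φ≡raiseBottom∘T0 : ∀ {m} h1 (v : Vec ℕ (suc m)) → IsLehmerCode v → firstZero v < h1 →
  φ (suc m) h1 v ≡ raiseBottom (T0 (suc m) v)
φ≡raiseBottom∘T0 h1 v@(zero ∷ _) code _ with T0-head v code
... | M , T0≡ = trans T0≡ (cong raiseBottom (sym T0≡))
φ≡raiseBottom∘T0 {m} h1 v@(suc _ ∷ _) code fz<h1 with T0-head v code
... | M , T0≡ = begin
  insertBelow1 (kprime h1 v) (removeEntry (kprime h1 v) (T0 (suc m) v))
    ≡⟨ cong₂ (λ k C → insertBelow1 k (removeEntry k C)) (kprime-firstZero h1 v fz<h1) T0≡ ⟩
  insertBelow1 b (removeEntry b (b ∷ M))  ≡⟨ cong (insertBelow1 b) (removeEntry-head b M) ⟩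
  insertBelow1 b M                        ≡⟨ cong raiseBottom T0≡ ⟨
  raiseBottom (T0 (suc m) v)              ∎
  where
  open ≡-Reasoning
  b = suc (firstZero v)

bottom-T0 : ∀ {m} (v : Vec ℕ (suc m)) → IsLehmerCode v →
  bottom (T0 (suc m) v) ≡ suc (firstZero v)
bottom-T0 v code = cong bottom (proj₂ (T0-head v code))

module Columns (m h1 : ℕ) where

  _<P_ : ℕ → ℕ → Set
  i <P j = i <Ph[ suc m , h1 ] j

  In2‥n : ℕ → Set
  In2‥n y = 2 ≤ y × y ≤ suc m

  1∉-In2‥n : ∀ {xs} → All In2‥n xs → 1 ∉ xs
  1∉-In2‥n xs-in = All¬⇒¬Any (All.map (<⇒≢ ∘ proj₁) xs-in)

  1∉-rotateˡ : ∀ {xs} → All In2‥n xs → 1 ∉ rotateˡ xs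
  1∉-rotateˡ {xs} xs-in = 1∉-In2‥n xs-in ∘ ∈-resp-↭ (rotateˡ-↭ xs)

  column-split : ∀ {C} → C ↭ range (suc m) →
    ∃₂ λ xs ys → C ≡ xs ++ 1 ∷ ys × All In2‥n xs × All In2‥n ys
  column-split C↭ with ∈-∃++ (∈-resp-↭ (↭-sym C↭) (here refl))
  ... | xs , ys , refl = xs , ys , refl , ++⁻ xs (All-resp-↭ (↭-sym rest↭) interval-2‥n)
    where
    rest↭ : xs ++ ys ↭ interval 2 m
    rest↭ = drop-mid xs [] (subst (xs ++ 1 ∷ ys ↭_) (range≡interval (suc m)) C↭)
    interval-2‥n : All In2‥n (interval 2 m)
    interval-2‥n = All.map (λ (2≤y , y<) → 2≤y , s≤s⁻¹ y<) (interval-bounds 2 m)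

  ≥2-≮ : ∀ {x y} → x ≤ suc m → 2 ≤ y → ¬ (y <P x)
  ≥2-≮ x≤n (s≤s (s≤s _)) = ≤⇒≯ x≤n

  ColAdj-≥2 : ∀ {x ys} → x ≤ suc m → All In2‥n ys → ColAdj _<P_ (x ∷ ys)
  ColAdj-≥2 _   []                    = tt
  ColAdj-≥2 x≤n ((2≤y , y≤n) ∷ ys-in) = ≥2-≮ x≤n 2≤y , ColAdj-≥2 y≤n ys-in

  ColAdj-++ : ∀ {xs y ys} → All In2‥n xs → In2‥n y → ColAdj _<P_ (y ∷ ys) →
    ColAdj _<P_ (xs ++ y ∷ ys)
  ColAdj-++ []                                   _         adj = adj
  ColAdj-++ ((_ , x≤n) ∷ [])                     (2≤y , _) adj = ≥2-≮ x≤n 2≤y , adj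
  ColAdj-++ ((_ , x≤n) ∷ x′-in@(2≤x′ , _) ∷ xs-in) y-in      adj =
    ≥2-≮ x≤n 2≤x′ , ColAdj-++ (x′-in ∷ xs-in) y-in adj

  raiseBottom-tableau : ∀ {C} → C ↭ range (suc m) → bottom C ≤ h1 →
    IsColumnPTableau (suc m) _<P_ (raiseBottom C)
  raiseBottom-tableau C↭ b≤h1 with column-split C↭
  ... | [] , ys , refl , [] , ys-in = C↭ , ColAdj-≥2 (s≤s z≤n) ys-in
  ... | b ∷ xs , ys , refl , b-in ∷ xs-in , ys-in =
    subst (IsColumnPTableau (suc m) _<P_)
          (sym (raiseBottom-split (b ∷ xs) ys (1∉-In2‥n (b-in ∷ xs-in))))
          (↭-trans (++⁺ʳ (1 ∷ ys) (rotateˡ-↭ (b ∷ xs))) C↭ , adj)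
    where
    adj : ColAdj _<P_ ((xs ∷ʳ b) ++ 1 ∷ ys)
    adj = subst (ColAdj _<P_) (sym (∷ʳ-++ xs b (1 ∷ ys)))
                (ColAdj-++ xs-in b-in (≤⇒≯ b≤h1 , ColAdj-≥2 (s≤s z≤n) ys-in))

  raiseBottom-injective : ∀ {C C′} → C ↭ range (suc m) → C′ ↭ range (suc m) →
    raiseBottom C ≡ raiseBottom C′ → C ≡ C′
  raiseBottom-injective C↭ C′↭ eq with column-split C↭ | column-split C′↭
  ... | xs , ys , refl , xs-in , _ | xs′ , ys′ , refl , xs′-in , _
    with rot≡ , refl ← split-at-first-unique (rotateˡ xs) (rotateˡ xs′)
                         (1∉-rotateˡ xs-in) (1∉-rotateˡ xs′-in)
                         (trans (sym (raiseBottom-split xs ys (1∉-In2‥n xs-in)))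
                                (trans eq (raiseBottom-split xs′ ys′ (1∉-In2‥n xs′-in))))
    = cong (_++ 1 ∷ ys) (rotateˡ-injective xs xs′ rot≡)

  raiseBottom-surjective : 1 ≤ h1 → ∀ {T} → T ↭ range (suc m) → ColAdj _<P_ T →
    ∃ λ C → C ↭ range (suc m) × bottom C ≤ h1 × raiseBottom C ≡ T
  raiseBottom-surjective 1≤h1 T↭ adj with column-split T↭
  ... | xs , ys , refl , xs-in , _ with initLast xs
  ...   | []        = 1 ∷ ys , T↭ , 1≤h1 , refl
  ...   | xs′ ∷ʳ′ b =
    b ∷ xs′ ++ 1 ∷ ys ,
    ↭-trans (↭-sym (++⁺ʳ (1 ∷ ys) (rotateˡ-↭ (b ∷ xs′)))) T↭ ,
    ≮⇒≥ (ColAdj-adjacent xs′ (subst (ColAdj _<P_) (∷ʳ-++ xs′ b (1 ∷ ys)) adj)) ,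
    raiseBottom-split (b ∷ xs′) ys (1∉-In2‥n (All-resp-↭ (↭-sym (∷↭∷ʳ b xs′)) xs-in))

module Bijection {m h1 : ℕ} (1≤h1 : 1 ≤ h1) (h1≤n : h1 ≤ suc m) where
  open Columns m h1
  open Equivalence

  φ-tableau : ∀ v → InB1 (suc m) h1 v → IsColumnPTableau (suc m) _<P_ (φ (suc m) h1 v)
  φ-tableau v v∈B1 with to (InB1⇔ v h1≤n) v∈B1
  ... | code , fz<h1 =
    subst (IsColumnPTableau (suc m) _<P_) (sym (φ≡raiseBottom∘T0 h1 v code fz<h1))
          (raiseBottom-tableau (T0-↭ v) (subst (_≤ h1) (sym (bottom-T0 v code)) fz<h1))

  φ-injective : ∀ v w → InB1 (suc m) h1 v → InB1 (suc m) h1 w →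
    φ (suc m) h1 v ≡ φ (suc m) h1 w → v ≡ w
  φ-injective v w v∈B1 w∈B1 φv≡φw with to (InB1⇔ v h1≤n) v∈B1 | to (InB1⇔ w h1≤n) w∈B1
  ... | code-v , fz<-v | code-w , fz<-w =
    T0-injective v w code-v code-w (raiseBottom-injective (T0-↭ v) (T0-↭ w) (begin
      raiseBottom (T0 (suc m) v)  ≡⟨ φ≡raiseBottom∘T0 h1 v code-v fz<-v ⟨
      φ (suc m) h1 v              ≡⟨ φv≡φw ⟩
      φ (suc m) h1 w              ≡⟨ φ≡raiseBottom∘T0 h1 w code-w fz<-w ⟩
      raiseBottom (T0 (suc m) w)  ∎))
    where open ≡-Reasoning

  φ-surjective : ∀ T → IsColumnPTableau (suc m) _<P_ T →
    ∃ λ v → InB1 (suc m) h1 v × φ (suc m) h1 v ≡ T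
  φ-surjective T (T↭ , adj) with raiseBottom-surjective 1≤h1 T↭ adj
  ... | C , C↭ , bottom≤h1 , raise≡T with T0-surjective C↭
  ... | v , code , T0≡C = v , from (InB1⇔ v h1≤n) (code , fz<h1) , (begin
      φ (suc m) h1 v              ≡⟨ φ≡raiseBottom∘T0 h1 v code fz<h1 ⟩
      raiseBottom (T0 (suc m) v)  ≡⟨ cong raiseBottom T0≡C ⟩
      raiseBottom C               ≡⟨ raise≡T ⟩
      T                           ∎)
    where
    open ≡-Reasoning
    fz<h1 : firstZero v < h1
    fz<h1 = subst (_≤ h1) (trans (cong bottom (sym T0≡C)) (bottom-T0 v code)) bottom≤h1

theoremB : (n h1 : ℕ) → 2 ≤ n → 1 ≤ h1 → h1 ≤ n →
    ((v : Monomial n) → InB1 n h1 v → IsColumnPTableau n (λ i j → i <Ph[ n , h1 ] j) (φ n h1 v))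
    × ((v w : Monomial n) → InB1 n h1 v → InB1 n h1 w → φ n h1 v ≡ φ n h1 w → v ≡ w)
    × ((T : List ℕ) → IsColumnPTableau n (λ i j → i <Ph[ n , h1 ] j) T →
         Σ (Monomial n) (λ v → InB1 n h1 v × φ n h1 v ≡ T))
theoremB zero    h1 () _ _
theoremB (suc m) h1 _ 1≤h1 h1≤n = φ-tableau , φ-injective , φ-surjective
  where open Bijection 1≤h1 h1≤n
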